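{- Let $S,P,Q$ be pairwise disjoint finite sets, and let $\mathcal{K}_{SP},\mathcal{K}_{SQ}$ be collections of vectors on $S\uplus P$, $S\uplus Q$ respectively. 1. There exists a collection of vectors $\mathcal{K}_{PQ}$ on $P\uplus Q$ with $0_{PQ}\in\mathcal{K}_{PQ}$ and $\mathcal{K}_{SP}\leftrightarrow\mathcal{K}_{PQ}=\mathcal{K}_{SQ}$ only if $\mathcal{K}_{SP}\circ S\supseteq\mathcal{K}_{SQ}\circ S$ and $\mathcal{K}_{SP}\times S\subseteq \mathcal{K}_{SQ}\times S$. 2. Suppose $\mathcal{K}_{SP}$ is closed under subtraction, $\mathcal{K}_{SQ}$ is closed under addition, $\mathcal{K}_{SP}\circ S\supseteq\mathcal{K}_{SQ}\circ S$ and $\mathcal{K}_{SP}\times S\subseteq \mathcal{K}_{SQ}\times S$. Then $0_{SQ}\in\mathcal{K}_{SQ}$, the collection $\mathcal{K}_{SP}\leftrightarrow\mathcal{K}_{SQ}$ (on $P\uplus Q$) is closed under addition and contains $0_{PQ}$, and $\mathcal{K}_{SP}\leftrightarrow(\mathcal{K}_{SP}\leftrightarrow\mathcal{K}_{SQ})=\mathcal{K}_{SQ}$. 3. Under the hypotheses of part 2, the equation $\mathcal{K}_{SP}\leftrightarrow\mathcal{K}_{PQ}=\mathcal{K}_{SQ}$, where the unknown $\mathcal{K}_{PQ}$ is required to be closed under addition and to satisfy $\mathcal{K}_{SP}\times P\subseteq\mathcal{K}_{PQ}\times P$ and $\mathcal{K}_{SP}\circ P\supseteq\mathcal{K}_{PQ}\circ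 P$, has $\hat{\mathcal{K}}_{PQ}:=\mathcal{K}_{SP}\leftrightarrow\mathcal{K}_{SQ}$ as its unique solution.
   Context: All vectors are over $\mathbb{Q}$; a vector on a finite set $X$ is a function $X\to\mathbb{Q}$, $0_X$ the zero vector, and $(f_X,g_Y)$ denotes the vector on $X\uplus Y$ formed from $f_X$ and $g_Y$. By the paper's convention every collection of vectors $\mathcal{K}_X$ considered contains the zero vector $0_X$. Restriction: $\mathcal{K}_{SP}\circ S=\{f_S:\exists f_P,(f_S,f_P)\in\mathcal{K}_{SP}\}$; contraction: $\mathcal{K}_{SP}\times S=\{f_S:(f_S,0_P)\in\mathcal{K}_{SP}\}$. Matched composition of $\mathcal{K}_{AB}$ and $\mathcal{K}_{BC}$ ($A,B,C$ pairwise disjoint; vectors are indexed by sets so $\mathcal{K}_{AB}=\mathcal{K}_{BA}$): $\mathcal{K}_{AB}\leftrightarrow\mathcal{K}_{BC}=\{(f_A,g_C):\exists h_B,\ (f_A,h_B)\in\mathcal{K}_{AB},\ (h_B,g_C)\in\mathcal{K}_{BC}\}$. In particular $\mathcal{K}_{SP}\leftrightarrow\mathcal{K}_{SQ}=\{(f_P,g_Q):\exists f_S,(f_S,f_P)\in\mathcal{K}_{SP},(f_S,g_Q)\in\mathcal{K}_{SQ}\}$. -}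

module Defs where

open import Level using (0ℓ)
open import Data.Nat using (ℕ)
open import Data.Rational using (ℚ; 0ℚ; _+_; _-_)
open import Data.Vec using (Vec; replicate; zipWith)
open import Data.Product using (Σ; ∃; _×_)

-- A vector on a finite set X with |X| = n, i.e. a function X → ℚ,
-- represented as Vec ℚ n (entries indexed by Fin n).
Vector : ℕ → Set
Vector n = Vec ℚ n

0v : ∀ {n} → Vector n
0v {n} = replicate n 0ℚ

_+v_ : ∀ {n} → Vector n → Vector n → Vector n
_+v_ = zipWith _+_

_-v_ : ∀ {n} → Vector n → Vector n → Vector n
_-v_ = zipWith _-_

-- A collection of vectors on X ⊎ Y (|X| = m, |Y| = n): a vector on X ⊎ Y
-- is the pair (f_X , f_Y); the collection is a predicate on such pairs.
Coll : ℕ → ℕ → Set₁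
Coll m n = Vector m → Vector n → Set

transpose : ∀ {m n} → Coll m n → Coll n m
transpose K g f = K f g

restr : ∀ {m n} → Coll m n → Vector m → Set
restr K f = ∃ λ g → K f g

contr : ∀ {m n} → Coll m n → Vector m → Set
contr K f = K f 0v

_⟷_ : ∀ {a b c} → Coll a b → Coll b c → Coll a c
(K ⟷ L) f h = ∃ λ g → K f g × L g h

_⊆₁_ : ∀ {n} → (Vector n → Set) → (Vector n → Set) → Set
A ⊆₁ B = ∀ f → A f → B f

_⊆₂_ : ∀ {m n} → Coll m n → Coll m n → Set
K ⊆₂ L = ∀ f g → K f g → L f g

_≐_ : ∀ {m n} → Coll m n → Coll m n → Set
K ≐ L = (K ⊆₂ L) × (L ⊆₂ K)

ClosedAdd : ∀ {m n} → Coll m n → Set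
ClosedAdd K = ∀ f g f' g' → K f g → K f' g' → K (f +v f') (g +v g')

ClosedSub : ∀ {m n} → Coll m n → Set
ClosedSub K = ∀ f g f' g' → K f g → K f' g' → K (f -v f') (g -v g')

-- Every vector of K_SP ↔ K_PQ has its S-part in K_SP ∘ S, and (f, 0) ∈ K_SP gives
-- (f, 0) ∈ K_SP ↔ K_PQ via (0, 0) ∈ K_PQ; this yields the necessary conditions.
-- Conversely, if f, f' on S have a common K_SP-partner on P, then f − f' ∈ K_SP × S
-- ⊆ K_SQ × S, so adding (f − f', 0) turns a K_SQ-partner of f' into one of f. This
-- transport shows both K_SP ↔ (K_SP ↔ K_SQ) ⊆ K_SQ and, with the roles of Q and P
-- exchanged, that every admissible K_PQ contains K_SP ↔ K_SQ; the reverse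
-- inclusions only need the hypotheses on restrictions.
module Submission where

open import Defs
open import Data.Nat using (ℕ)
open import Data.Product using (Σ; _×_; _,_)
open import Data.Vec using ([]; _∷_)
open import Data.Vec.Properties using (zipWith-identityˡ)
open import Data.Rational using (_+_; -_)
import Data.Rational.Properties as ℚ
open import Algebra.Properties.Group ℚ.+-0-group using (⁻¹-involutive; //-rightDividesˡ)
open import Relation.Binary.PropositionalEquality using (_≡_; refl; trans; cong; cong₂; subst; subst₂)

private
  variable
    a b c : ℕ
    K : Coll a b
    L : Coll b c
    M : Coll a c

f-f≡0v : (f : Vector a) → f -v f ≡ 0v
f-f≡0v []      = refl
f-f≡0v (x ∷ f) = cong₂ _∷_ (ℚ.+-inverseʳ x) (f-f≡0v f)

[f-g]+g≡f : (f g : Vector a) → (f -v g) +v g ≡ f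
[f-g]+g≡f []      []      = refl
[f-g]+g≡f (x ∷ f) (y ∷ g) = cong₂ _∷_ (//-rightDividesˡ y x) ([f-g]+g≡f f g)

0v+f≡f : (f : Vector a) → 0v +v f ≡ f
0v+f≡f = zipWith-identityˡ ℚ.+-identityˡ

f-[0-g]≡f+g : (f g : Vector a) → f -v (0v -v g) ≡ f +v g
f-[0-g]≡f+g []      []      = refl
f-[0-g]≡f+g (x ∷ f) (y ∷ g) =
  cong₂ _∷_ (cong (x +_) (trans (cong -_ (ℚ.+-identityˡ (- y))) (⁻¹-involutive y)))
            (f-[0-g]≡f+g f g)

⊆₂-refl : K ⊆₂ K
⊆₂-refl _ _ k = k

closedSub-transpose : ClosedSub K → ClosedSub (transpose K)
closedSub-transpose sub g f g' f' k k' = sub f g f' g' k k'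

closedSub⇒closedAdd : K 0v 0v → ClosedSub K → ClosedAdd K
closedSub⇒closedAdd {K = K} 0∈K sub f g f' g' k k' =
  subst₂ K (f-[0-g]≡f+g f f') (f-[0-g]≡f+g g g') (sub f g _ _ k (sub 0v 0v f' g' 0∈K k'))

⟷-closedAdd : ClosedAdd K → ClosedAdd L → ClosedAdd (K ⟷ L)
⟷-closedAdd addK addL f h f' h' (g , k , l) (g' , k' , l') =
  g +v g' , addK f g f' g' k k' , addL g h g' h' l l'

restr-⊆-⟷ : M ⊆₂ (K ⟷ L) → restr M ⊆₁ restr K
restr-⊆-⟷ M⊆K⟷L f (h , m) = let (g , k , _) = M⊆K⟷L f h m in g , k

contr-⟷-⊆ : L 0v 0v → (K ⟷ L) ⊆₂ M → contr K ⊆₁ contr M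
contr-⟷-⊆ 0∈L K⟷L⊆M f k = K⟷L⊆M f 0v (0v , k , 0∈L)

closedSub⇒contr-difference : ClosedSub K → ∀ {f f' g} → K f g → K f' g → contr K (f -v f')
closedSub⇒contr-difference {K = K} sub {f} {f'} {g} k k' =
  subst (K (f -v f')) (f-f≡0v g) (sub f g f' g k k')

transport-along-partner : {L : Coll a c} → ClosedSub K → ClosedAdd L → contr K ⊆₁ contr L
  → ∀ {f f' g h} → K f g → K f' g → L f' h → L f h
transport-along-partner {L = L} sub add contrK⊆contrL {f} {f'} {g} {h} k k' l =
  subst₂ L ([f-g]+g≡f f f') (0v+f≡f h)
    (add _ _ f' h (contrK⊆contrL _ (closedSub⇒contr-difference sub k k')) l)

⊆-transpose-⟷ : restr L ⊆₁ restr (transpose K) → (K ⟷ L) ⊆₂ M → L ⊆₂ (transpose K ⟷ M)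
⊆-transpose-⟷ restrL⊆restrK K⟷L⊆M g h l =
  let (f , k) = restrL⊆restrK g (h , l) in f , k , K⟷L⊆M f h (g , k , l)

transpose-⟷-⊆ : ClosedSub (transpose K) → ClosedAdd L → contr (transpose K) ⊆₁ contr L
  → M ⊆₂ (K ⟷ L) → (transpose K ⟷ M) ⊆₂ L
transpose-⟷-⊆ sub add contrK⊆contrL M⊆K⟷L g h (f , k , m) =
  let (g' , k' , l') = M⊆K⟷L f h m in transport-along-partner sub add contrK⊆contrL k k' l'

lemma2 : (s p q : ℕ) (KSP : Coll s p) (KSQ : Coll s q)
  → KSP 0v 0v
  → ((Σ (Coll p q) λ KPQ → KPQ 0v 0v × ((KSP ⟷ KPQ) ≐ KSQ))
      → (restr KSQ ⊆₁ restr KSP) × (contr KSP ⊆₁ contr KSQ))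
  × (ClosedSub KSP → ClosedAdd KSQ
      → restr KSQ ⊆₁ restr KSP → contr KSP ⊆₁ contr KSQ
      → KSQ 0v 0v
        × ClosedAdd (transpose KSP ⟷ KSQ)
        × (transpose KSP ⟷ KSQ) 0v 0v
        × ((KSP ⟷ (transpose KSP ⟷ KSQ)) ≐ KSQ))
  × (ClosedSub KSP → ClosedAdd KSQ
      → restr KSQ ⊆₁ restr KSP → contr KSP ⊆₁ contr KSQ
      → (ClosedAdd (transpose KSP ⟷ KSQ)
          × (contr (transpose KSP) ⊆₁ contr (transpose KSP ⟷ KSQ))
          × (restr (transpose KSP ⟷ KSQ) ⊆₁ restr (transpose KSP))
          × ((KSP ⟷ (transpose KSP ⟷ KSQ)) ≐ KSQ))
        × ((KPQ : Coll p q) → ClosedAdd KPQ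
            → contr (transpose KSP) ⊆₁ contr KPQ
            → restr KPQ ⊆₁ restr (transpose KSP)
            → (KSP ⟷ KPQ) ≐ KSQ
            → KPQ ≐ (transpose KSP ⟷ KSQ)))
lemma2 s p q KSP KSQ 0∈SP =
  (λ (KPQ , 0∈PQ , SP⟷PQ⊆SQ , SQ⊆SP⟷PQ) →
     restr-⊆-⟷ {L = KPQ} SQ⊆SP⟷PQ , contr-⟷-⊆ 0∈PQ SP⟷PQ⊆SQ) ,
  (λ sub add r c → 0∈SQ c , K̂-closedAdd sub add , (0v , 0∈SP , 0∈SQ c) , K̂-solves sub add r c) ,
  (λ sub add r c →
     (K̂-closedAdd sub add ,
      contr-⟷-⊆ {L = KSQ} (0∈SQ c) ⊆₂-refl ,
      restr-⊆-⟷ {L = KSQ} ⊆₂-refl ,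
      K̂-solves sub add r c) ,
     (λ KPQ addPQ c' r' (SP⟷PQ⊆SQ , SQ⊆SP⟷PQ) →
        ⊆-transpose-⟷ r' SP⟷PQ⊆SQ ,
        transpose-⟷-⊆ (closedSub-transpose sub) addPQ c' SQ⊆SP⟷PQ))
  where
  K̂ : Coll p q
  K̂ = transpose KSP ⟷ KSQ

  0∈SQ : contr KSP ⊆₁ contr KSQ → KSQ 0v 0v
  0∈SQ c = c 0v 0∈SP

  K̂-closedAdd : ClosedSub KSP → ClosedAdd KSQ → ClosedAdd K̂
  K̂-closedAdd sub add = ⟷-closedAdd (closedSub⇒closedAdd 0∈SP (closedSub-transpose sub)) add

  K̂-solves : ClosedSub KSP → ClosedAdd KSQ → restr KSQ ⊆₁ restr KSP → contr KSP ⊆₁ contr KSQ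
    → (KSP ⟷ K̂) ≐ KSQ
  K̂-solves sub add r c =
    transpose-⟷-⊆ {K = transpose KSP} sub add c ⊆₂-refl ,
    ⊆-transpose-⟷ {K = transpose KSP} r ⊆₂-refl
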